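{- Let $\Omega$ be a finite set of size $n$ and $1\le r\le n$. The (non-empty) poset $(\mathrm{Dom}(r,\Omega),\leqslant)$ of domination completions of $\mathcal{U}_{r,\Omega}$ has a unique minimal element if and only if $\mathcal{U}_{r,\Omega}$ is a domination hypergraph.
   Context: Graphs are finite, simple, undirected; $\mathcal{D}(G)$ is the family of inclusion-minimal dominating sets of $G$ (a dominating set is $D\subseteq V(G)$ such that every vertex outside $D$ has a neighbour in $D$). A hypergraph on $\Omega$ is a nonempty family of nonempty subsets of $\Omega$, none a proper subset of another; it has ground set $\Omega$ if the union of its members is $\Omega$. A domination hypergraph is one of the form $\mathcal{D}(G)$ for a graph $G$. $\mathcal{U}_{r,\Omega}=\{A\subseteq\Omega:|A|=r\}$. For hypergraphs $\mathcal{H}_1,\mathcal{H}_2$ on $\Omega$, $\mathcal{H}_1\leqslant\mathcal{H}_2$ means: for every $A_1\in\mathcal{H}_1$ there is $A_2\in\mathcal{H}_2$ with $A_2\subseteq A_1$ (a partial order). $\mathrm{Dom}(r,\Omega)$ is the set of domination hypergraphs $\mathcal{H}$ with ground set $\Omega$ such that $\mathcal{U}_{r,\Omega}\leqslant\mathcal{H}$ (domination completions). -}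

module Defs where

open import Data.Nat using (ℕ)
open import Data.Fin using (Fin)
open import Data.Fin.Subset using (Subset; _∈_; _∉_; _⊆_; _⊂_; ∣_∣; Nonempty)
open import Data.Product using (Σ; ∃; ∃-syntax; _×_; _,_)
open import Data.Sum using (_⊎_)
open import Relation.Nullary using (¬_)
open import Relation.Binary.PropositionalEquality using (_≡_)
open import Function.Bundles using (_⇔_)
open import Level using (0ℓ)

record Graph (n : ℕ) : Set₁ where
  field
    Adj     : Fin n → Fin n → Set
    sym     : ∀ {u v} → Adj u v → Adj v u
    irrefl  : ∀ {v} → ¬ Adj v v
open Graph public

Dominating : ∀ {n} → Graph n → Subset n → Set
Dominating G D = ∀ v → v ∉ D → ∃[ u ] (u ∈ D × Adj G u v)

MinDominating : ∀ {n} → Graph n → Subset n → Set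
MinDominating G D = Dominating G D × (∀ D' → D' ⊂ D → ¬ Dominating G D')

Family : ℕ → Set₁
Family n = Subset n → Set

𝒟 : ∀ {n} → Graph n → Family n
𝒟 G = MinDominating G

_≐_ : ∀ {n} → Family n → Family n → Set
H₁ ≐ H₂ = ∀ A → H₁ A ⇔ H₂ A

IsHypergraph : ∀ {n} → Family n → Set
IsHypergraph H = (∃[ A ] H A)
               × (∀ A → H A → Nonempty A)
               × (∀ A B → H A → H B → ¬ (A ⊂ B))

HasGroundSet : ∀ {n} → Family n → Set
HasGroundSet H = ∀ x → ∃[ A ] (H A × x ∈ A)

IsDominationHypergraph : ∀ {n} → Family n → Set₁
IsDominationHypergraph {n} H = IsHypergraph H × Σ (Graph n) (λ G → H ≐ 𝒟 G)

𝒰 : ∀ {n} → ℕ → Family n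
𝒰 r A = ∣ A ∣ ≡ r

_⩽_ : ∀ {n} → Family n → Family n → Set
H₁ ⩽ H₂ = ∀ A₁ → H₁ A₁ → ∃[ A₂ ] (H₂ A₂ × A₂ ⊆ A₁)

Dom : ∀ {n} → ℕ → Family n → Set₁
Dom {n} r H = IsDominationHypergraph H × HasGroundSet H × (𝒰 {n} r ⩽ H)

IsMinimalDom : ∀ {n} → ℕ → Family n → Set₁
IsMinimalDom {n} r H = Dom r H × (∀ H' → Dom r H' → H' ⩽ H → H' ≐ H)

HasUniqueMinimal : ℕ → ℕ → Set₁
HasUniqueMinimal n r = Σ (Family n) (λ H → IsMinimalDom r H × (∀ H' → IsMinimalDom r H' → H' ≐ H))

-- A unique minimal completion H is invariant under every permutation of Ω (relabelling a minimal
-- completion gives a minimal completion), so, being an antichain, H = 𝒰ₖ for some 1 ≤ k ≤ r. If k < r,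
-- take a (k−1)-set Y: it lies strictly inside a minimal dominating k-set, so it fails to dominate some
-- vertex y, and y has a neighbour x (every k-set avoiding y dominates y). Deleting the edge xy gives a
-- graph G' in which every set of size > k still dominates, so 𝒟(G') is a completion below H and hence
-- equal to H; but Y ∪ {x} ∈ H no longer dominates y in G'. Hence k = r. Conversely, if 𝒰ᵣ is a
-- domination hypergraph it is a completion lying below every completion, so it is the unique minimal one.
module Submission where

open import Defs hiding (sym)
open import Data.Nat using (ℕ; zero; suc; _≤_; _<_; z≤n; s≤s; s≤s⁻¹)
open import Data.Nat.Properties
  using (≤-refl; ≤-trans; ≤-<-trans; <-≤-trans; ≤-antisym; <⇒≤; ≰⇒>; _≤?_; n≤1+n; suc-injective; <-cmp; m≤n⇒m<n∨m≡n)
import Data.Bool as Bool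
open import Data.Fin using (Fin; zero; suc; _≟_)
open import Data.Fin.Properties using (any?; all?; ¬∀⟶∃¬; sequence)
open import Data.Fin.Permutation using (Permutation′; _⟨$⟩ʳ_; _⟨$⟩ˡ_; inverseˡ; inverseʳ; flip; lift₀; transpose)
open import Data.Fin.Subset
open import Data.Fin.Subset.Properties
open import Data.Fin.Subset.Induction using (⊂-wellFounded)
open import Data.Vec using ([]; _∷_; here; there; lookup; tabulate; _[_]≔_)
open import Data.Vec.Properties
  using (lookup∘tabulate; tabulate∘lookup; tabulate-cong; []=⇒lookup; lookup⇒[]=; lookup∘update; lookup∘update′)
open import Data.Product using (∃-syntax; _×_; _,_; proj₁; proj₂)
open import Data.Sum using (inj₁; inj₂; [_,_]′)
open import Data.Empty using (⊥-elim)
open import Effect.Monad using (RawMonad)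
open import Function.Bundles using (mk⇔; Equivalence)
import Function.Properties.Equivalence as ⇔
open import Induction.WellFounded using (Acc; acc)
open import Relation.Binary using (tri<; tri≈; tri>)
open import Relation.Binary.PropositionalEquality
  using (_≡_; refl; cong; sym; trans; subst; subst₂; module ≡-Reasoning)
open import Relation.Nullary using (¬_; Dec; yes; no; does)
open import Relation.Nullary.Decidable using (_×-dec_; _→-dec_; ¬?; dec-true; ¬¬-excluded-middle)
open import Relation.Nullary.Negation using (¬¬-Monad)

open Equivalence using (to; from)

subset-of-size-between : ∀ {n} {A C : Subset n} {m} → A ⊆ C → ∣ A ∣ ≤ m → m ≤ ∣ C ∣ →
                         ∃[ K ] A ⊆ K × K ⊆ C × ∣ K ∣ ≡ m
subset-of-size-between {A = []} {[]} {zero} _ _ _ = [] , ⊆-refl , ⊆-refl , refl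
subset-of-size-between {A = inside ∷ A} {outside ∷ C} A⊆C with () ← A⊆C here
subset-of-size-between {A = inside ∷ A} {inside ∷ C} {suc m} A⊆C (s≤s ∣A∣≤m) (s≤s m≤∣C∣)
  with K , A⊆K , K⊆C , ∣K∣≡m ← subset-of-size-between (drop-∷-⊆ A⊆C) ∣A∣≤m m≤∣C∣
  = inside ∷ K , in⊆in A⊆K , in⊆in K⊆C , cong suc ∣K∣≡m
subset-of-size-between {A = outside ∷ A} {outside ∷ C} A⊆C ∣A∣≤m m≤∣C∣
  with K , A⊆K , K⊆C , ∣K∣≡m ← subset-of-size-between (drop-∷-⊆ A⊆C) ∣A∣≤m m≤∣C∣
  = outside ∷ K , s⊆s A⊆K , s⊆s K⊆C , ∣K∣≡m
subset-of-size-between {A = outside ∷ A} {inside ∷ C} {m} A⊆C ∣A∣≤m m≤1+∣C∣ with m ≤? ∣ C ∣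
... | yes m≤∣C∣ with K , A⊆K , K⊆C , ∣K∣≡m ← subset-of-size-between (drop-∷-⊆ A⊆C) ∣A∣≤m m≤∣C∣
  = outside ∷ K , s⊆s A⊆K , out⊆ K⊆C , ∣K∣≡m
... | no m≰∣C∣ = inside ∷ C , out⊆ (drop-∷-⊆ A⊆C) , ⊆-refl , ≤-antisym (≰⇒> m≰∣C∣) m≤1+∣C∣

subset-of-size : ∀ {n} {C : Subset n} {m} → m ≤ ∣ C ∣ → ∃[ K ] K ⊆ C × ∣ K ∣ ≡ m
subset-of-size {n} m≤∣C∣
  with K , _ , K⊆C , ∣K∣≡m ← subset-of-size-between ⊥⊆ (subst (_≤ _) (sym (∣⊥∣≡0 n)) z≤n) m≤∣C∣
  = K , K⊆C , ∣K∣≡m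

superset-of-size : ∀ {n} {A : Subset n} {m} → ∣ A ∣ ≤ m → m ≤ n → ∃[ K ] A ⊆ K × ∣ K ∣ ≡ m
superset-of-size {n} ∣A∣≤m m≤n
  with K , A⊆K , _ , ∣K∣≡m ← subset-of-size-between ⊆⊤ ∣A∣≤m (subst (_ ≤_) (sym (∣⊤∣≡n n)) m≤n)
  = K , A⊆K , ∣K∣≡m

⊆∧∣<∣⇒⊂ : ∀ {n} {A B : Subset n} → A ⊆ B → ∣ A ∣ < ∣ B ∣ → A ⊂ B
⊆∧∣<∣⇒⊂ {A = outside ∷ A} {outside ∷ B} A⊆B ∣A∣<∣B∣ = s⊂s (⊆∧∣<∣⇒⊂ (drop-∷-⊆ A⊆B) ∣A∣<∣B∣)
⊆∧∣<∣⇒⊂ {A = outside ∷ A} {inside ∷ B} A⊆B _ = out⊂in (drop-∷-⊆ A⊆B)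
⊆∧∣<∣⇒⊂ {A = inside ∷ A} {outside ∷ B} A⊆B with () ← A⊆B here
⊆∧∣<∣⇒⊂ {A = inside ∷ A} {inside ∷ B} A⊆B (s≤s ∣A∣<∣B∣) = s⊂s (⊆∧∣<∣⇒⊂ (drop-∷-⊆ A⊆B) ∣A∣<∣B∣)

⊆∧⊄⇒⊇ : ∀ {n} {A B : Subset n} → A ⊆ B → ¬ A ⊂ B → B ⊆ A
⊆∧⊄⇒⊇ {A = A} A⊆B A⊄B {x} x∈B with x ∈? A
... | yes x∈A = x∈A
... | no x∉A = ⊥-elim (A⊄B (A⊆B , x , x∈B , x∉A))

p⊆q∧x∉p⇒p⊆q-x : ∀ {n} {p q : Subset n} {x} → p ⊆ q → x ∉ p → p ⊆ q - x
p⊆q∧x∉p⇒p⊆q-x p⊆q x∉p {y} y∈p = x∈p∧x≢y⇒x∈p-y (p⊆q y∈p) λ { refl → x∉p y∈p }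

x∈p─q⇒x∉q : ∀ {n} {p q : Subset n} {x} → x ∈ p ─ q → x ∉ q
x∈p─q⇒x∉q {p = _ ∷ _} {outside ∷ _} here ()
x∈p─q⇒x∉q {p = _ ∷ _} {_ ∷ _} (there x∈p─q) (there x∈q) = x∈p─q⇒x∉q x∈p─q x∈q

x∈p-y⇒x≢y : ∀ {n} {p : Subset n} {x y} → x ∈ p - y → ¬ x ≡ y
x∈p-y⇒x≢y {y = y} x∈p-y refl = x∈p─q⇒x∉q x∈p-y (x∈⁅x⁆ y)

∣p∪⁅x⁆∣≤1+∣p∣ : ∀ {n} (p : Subset n) x → ∣ p ∪ ⁅ x ⁆ ∣ ≤ suc ∣ p ∣
∣p∪⁅x⁆∣≤1+∣p∣ (inside ∷ p) zero rewrite ∪-identityʳ p = n≤1+n _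
∣p∪⁅x⁆∣≤1+∣p∣ (outside ∷ p) zero rewrite ∪-identityʳ p = ≤-refl
∣p∪⁅x⁆∣≤1+∣p∣ (inside ∷ p) (suc x) = s≤s (∣p∪⁅x⁆∣≤1+∣p∣ p x)
∣p∪⁅x⁆∣≤1+∣p∣ (outside ∷ p) (suc x) = ∣p∪⁅x⁆∣≤1+∣p∣ p x

x∉p⇒∣p∪⁅x⁆∣≡1+∣p∣ : ∀ {n} {p : Subset n} {x} → x ∉ p → ∣ p ∪ ⁅ x ⁆ ∣ ≡ suc ∣ p ∣
x∉p⇒∣p∪⁅x⁆∣≡1+∣p∣ {p = p} {x} x∉p = ≤-antisym (∣p∪⁅x⁆∣≤1+∣p∣ p x)
  (p⊂q⇒∣p∣<∣q∣ (p⊆p∪q ⁅ x ⁆ , x , x∈p∪q⁺ (inj₂ (x∈⁅x⁆ x)) , x∉p))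

∣p∣≤1+∣p-x∣ : ∀ {n} (p : Subset n) x → ∣ p ∣ ≤ suc ∣ p - x ∣
∣p∣≤1+∣p-x∣ p x = ≤-trans (p⊆q⇒∣p∣≤∣q∣ p⊆p-x∪⁅x⁆) (∣p∪⁅x⁆∣≤1+∣p∣ (p - x) x)
  where
  p⊆p-x∪⁅x⁆ : p ⊆ (p - x) ∪ ⁅ x ⁆
  p⊆p-x∪⁅x⁆ {y} y∈p with y ≟ x
  ... | yes refl = x∈p∪q⁺ (inj₂ (x∈⁅x⁆ x))
  ... | no y≢x = x∈p∪q⁺ (inj₁ (x∈p∧x≢y⇒x∈p-y y∈p y≢x))

m<∣p∣⇒m≤∣p-x∣ : ∀ {n m} (p : Subset n) x → m < ∣ p ∣ → m ≤ ∣ p - x ∣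
m<∣p∣⇒m≤∣p-x∣ p x m<∣p∣ = s≤s⁻¹ (≤-trans m<∣p∣ (∣p∣≤1+∣p-x∣ p x))

∣s∷p∣≡∣s∷q∣ : ∀ {n} s (p q : Subset n) → ∣ p ∣ ≡ ∣ q ∣ → ∣ s ∷ p ∣ ≡ ∣ s ∷ q ∣
∣s∷p∣≡∣s∷q∣ inside p q = cong suc
∣s∷p∣≡∣s∷q∣ outside p q ∣p∣≡∣q∣ = ∣p∣≡∣q∣

∣s∷p∣≡∣s∷q∣⇒∣p∣≡∣q∣ : ∀ {n} s (p q : Subset n) → ∣ s ∷ p ∣ ≡ ∣ s ∷ q ∣ → ∣ p ∣ ≡ ∣ q ∣
∣s∷p∣≡∣s∷q∣⇒∣p∣≡∣q∣ inside p q = suc-injective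
∣s∷p∣≡∣s∷q∣⇒∣p∣≡∣q∣ outside p q ∣p∣≡∣q∣ = ∣p∣≡∣q∣

∣s∷t∷p∣≡∣t∷s∷p∣ : ∀ {n} s t (p : Subset n) → ∣ s ∷ t ∷ p ∣ ≡ ∣ t ∷ s ∷ p ∣
∣s∷t∷p∣≡∣t∷s∷p∣ inside inside p = refl
∣s∷t∷p∣≡∣t∷s∷p∣ inside outside p = refl
∣s∷t∷p∣≡∣t∷s∷p∣ outside inside p = refl
∣s∷t∷p∣≡∣t∷s∷p∣ outside outside p = refl

∣lookup∷update∣ : ∀ {n} (p : Subset n) j s → ∣ lookup p j ∷ (p [ j ]≔ s) ∣ ≡ ∣ s ∷ p ∣
∣lookup∷update∣ (t ∷ p) zero s = ∣s∷t∷p∣≡∣t∷s∷p∣ t s p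
∣lookup∷update∣ (t ∷ p) (suc j) s = begin
  ∣ lookup p j ∷ t ∷ (p [ j ]≔ s) ∣  ≡⟨ ∣s∷t∷p∣≡∣t∷s∷p∣ (lookup p j) t (p [ j ]≔ s) ⟩
  ∣ t ∷ lookup p j ∷ (p [ j ]≔ s) ∣  ≡⟨ ∣s∷p∣≡∣s∷q∣ t (lookup p j ∷ (p [ j ]≔ s)) (s ∷ p) (∣lookup∷update∣ p j s) ⟩
  ∣ t ∷ s ∷ p ∣                      ≡⟨ ∣s∷t∷p∣≡∣t∷s∷p∣ t s p ⟩
  ∣ s ∷ t ∷ p ∣                      ∎
  where open ≡-Reasoning

lookup≡outside : ∀ {n} (p : Subset n) → ∣ p ∣ < n → ∃[ j ] lookup p j ≡ outside
lookup≡outside (outside ∷ p) _ = zero , refl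
lookup≡outside (inside ∷ p) (s≤s ∣p∣<n) with j , pj≡outside ← lookup≡outside p ∣p∣<n = suc j , pj≡outside

lookup≡inside : ∀ {n} (p : Subset n) → 0 < ∣ p ∣ → ∃[ j ] lookup p j ≡ inside
lookup≡inside (inside ∷ p) _ = zero , refl
lookup≡inside (outside ∷ p) 0<∣p∣ with j , pj≡inside ← lookup≡inside p 0<∣p∣ = suc j , pj≡inside

∃-lookup≡ : ∀ {n} {s t} (p q : Subset n) → ¬ s ≡ t → ∣ s ∷ p ∣ ≡ ∣ t ∷ q ∣ → ∃[ j ] lookup p j ≡ t
∃-lookup≡ {s = inside} {inside} p q s≢t _ = ⊥-elim (s≢t refl)
∃-lookup≡ {s = outside} {outside} p q s≢t _ = ⊥-elim (s≢t refl)
∃-lookup≡ {s = inside} {outside} p q _ ∣s∷p∣≡∣t∷q∣ = lookup≡outside p (subst (_≤ _) (sym ∣s∷p∣≡∣t∷q∣) (∣p∣≤n q))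
∃-lookup≡ {s = outside} {inside} p q _ ∣s∷p∣≡∣t∷q∣ = lookup≡inside p (subst (0 <_) (sym ∣s∷p∣≡∣t∷q∣) (s≤s z≤n))

decSubset : ∀ {n} {P : Fin n → Set} → (∀ x → Dec (P x)) → Subset n
decSubset P? = tabulate λ x → does (P? x)

module _ {n} {P : Fin n → Set} (P? : ∀ x → Dec (P x)) where

  ∈-decSubset⁺ : ∀ {x} → P x → x ∈ decSubset P?
  ∈-decSubset⁺ {x} Px = lookup⇒[]= x _ (trans (lookup∘tabulate _ x) (dec-true (P? x) Px))

  ∈-decSubset⁻ : ∀ {x} → x ∈ decSubset P? → P x
  ∈-decSubset⁻ {x} x∈ with P? x | trans (sym (lookup∘tabulate (λ x → does (P? x)) x)) ([]=⇒lookup x∈)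
  ... | yes Px | _ = Px
  ... | no _ | ()

-- Relabelling subsets along a permutation

relabel : ∀ {n} → Permutation′ n → Subset n → Subset n
relabel σ A = tabulate λ x → lookup A (σ ⟨$⟩ʳ x)

module _ {n} (σ : Permutation′ n) where

  ∈-relabel⁺ : ∀ {A x} → σ ⟨$⟩ʳ x ∈ A → x ∈ relabel σ A
  ∈-relabel⁺ {A} {x} σx∈A = lookup⇒[]= x _ (trans (lookup∘tabulate _ x) ([]=⇒lookup σx∈A))

  ∈-relabel⁻ : ∀ {A x} → x ∈ relabel σ A → σ ⟨$⟩ʳ x ∈ A
  ∈-relabel⁻ {A} {x} x∈σA = lookup⇒[]= (σ ⟨$⟩ʳ x) A (trans (sym (lookup∘tabulate _ x)) ([]=⇒lookup x∈σA))

  relabel-flip : ∀ A → relabel σ (relabel (flip σ) A) ≡ A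
  relabel-flip A = trans (tabulate-cong λ x → trans (lookup∘tabulate _ (σ ⟨$⟩ʳ x)) (cong (lookup A) (inverseˡ σ)))
                         (tabulate∘lookup A)

  flip-relabel : ∀ A → relabel (flip σ) (relabel σ A) ≡ A
  flip-relabel A = trans (tabulate-cong λ x → trans (lookup∘tabulate _ (σ ⟨$⟩ˡ x)) (cong (lookup A) (inverseʳ σ)))
                         (tabulate∘lookup A)

  relabel-⊆ : ∀ {A B} → A ⊆ B → relabel σ A ⊆ relabel σ B
  relabel-⊆ A⊆B x∈σA = ∈-relabel⁺ (A⊆B (∈-relabel⁻ x∈σA))

  relabel-⊂ : ∀ {A B} → A ⊂ B → relabel σ A ⊂ relabel σ B
  relabel-⊂ {A} {B} (A⊆B , x , x∈B , x∉A) =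
    relabel-⊆ A⊆B , σ ⟨$⟩ˡ x , ∈-relabel⁺ (subst (_∈ B) (sym (inverseʳ σ)) x∈B) ,
    λ σ⁻¹x∈σA → x∉A (subst (_∈ A) (inverseʳ σ) (∈-relabel⁻ σ⁻¹x∈σA))

-- Every permutation preserves sizes, but only lifts and transpositions with 0 are needed below, so
-- size preservation is carried as a hypothesis instead of being proved in general.
SizePreserving : ∀ {n} → Permutation′ n → Set
SizePreserving σ = ∀ A → ∣ relabel σ A ∣ ≡ ∣ A ∣

flip-sizePreserving : ∀ {n} {σ : Permutation′ n} → SizePreserving σ → SizePreserving (flip σ)
flip-sizePreserving {σ = σ} ∣σ∣ A = trans (sym (∣σ∣ (relabel (flip σ) A))) (cong ∣_∣ (relabel-flip σ A))

lift₀-sizePreserving : ∀ {n} {σ : Permutation′ n} → SizePreserving σ → SizePreserving (lift₀ σ)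
lift₀-sizePreserving {σ = σ} ∣σ∣ (s ∷ A) = ∣s∷p∣≡∣s∷q∣ s (relabel σ A) A (∣σ∣ A)

relabel-transpose₀ : ∀ {n} (j : Fin n) s p → relabel (transpose zero (suc j)) (s ∷ p) ≡ lookup p j ∷ (p [ j ]≔ s)
relabel-transpose₀ j s p = cong (lookup p j ∷_) (trans (tabulate-cong entry) (tabulate∘lookup (p [ j ]≔ s)))
  where
  entry : ∀ t → lookup (s ∷ p) (transpose zero (suc j) ⟨$⟩ʳ suc t) ≡ lookup (p [ j ]≔ s) t
  entry t with t ≟ j
  ... | yes refl = sym (lookup∘update t p s)
  ... | no t≢j = sym (lookup∘update′ t≢j p s)

transpose₀-sizePreserving : ∀ {n} (j : Fin n) → SizePreserving (transpose zero (suc j))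
transpose₀-sizePreserving j (s ∷ p) = trans (cong ∣_∣ (relabel-transpose₀ j s p)) (∣lookup∷update∣ p j s)

RelabellingInvariant : ∀ {n} → (Subset n → Set) → Set
RelabellingInvariant P = ∀ σ → SizePreserving σ → ∀ {A} → P A → P (relabel σ A)

tail-invariant : ∀ {n} {P : Subset (suc n) → Set} {s} → RelabellingInvariant P → RelabellingInvariant (λ X → P (s ∷ X))
tail-invariant invariant σ ∣σ∣ = invariant (lift₀ σ) (lift₀-sizePreserving {σ = σ} ∣σ∣)

-- Make the first entries agree, swapping position 0 with a suitable position j if necessary, and recurse.
invariant⇒size-determined : ∀ {n} {P : Subset n → Set} → RelabellingInvariant P →
                            ∀ {A B} → ∣ A ∣ ≡ ∣ B ∣ → P A → P B
invariant⇒size-determined {zero} _ {[]} {[]} _ PA = PA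
invariant⇒size-determined {suc n} {P} invariant {s ∷ A} {t ∷ B} ∣s∷A∣≡∣t∷B∣ PA with s Bool.≟ t
... | yes refl = invariant⇒size-determined (tail-invariant invariant) (∣s∷p∣≡∣s∷q∣⇒∣p∣≡∣q∣ s A B ∣s∷A∣≡∣t∷B∣) PA
... | no s≢t with j , Aj≡t ← ∃-lookup≡ A B s≢t ∣s∷A∣≡∣t∷B∣ =
  invariant⇒size-determined (tail-invariant invariant) (∣s∷p∣≡∣s∷q∣⇒∣p∣≡∣q∣ t (A [ j ]≔ s) B ∣swapped∣≡∣t∷B∣) Pswapped
  where
  Pswapped : P (t ∷ (A [ j ]≔ s))
  Pswapped = subst (λ u → P (u ∷ (A [ j ]≔ s))) Aj≡t
               (subst P (relabel-transpose₀ j s A) (invariant (transpose zero (suc j)) (transpose₀-sizePreserving j) PA))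
  ∣swapped∣≡∣t∷B∣ : ∣ t ∷ (A [ j ]≔ s) ∣ ≡ ∣ t ∷ B ∣
  ∣swapped∣≡∣t∷B∣ = trans (subst (λ u → ∣ u ∷ (A [ j ]≔ s) ∣ ≡ ∣ s ∷ A ∣) Aj≡t (∣lookup∷update∣ A j s)) ∣s∷A∣≡∣t∷B∣

≐-refl : ∀ {n} {F : Family n} → F ≐ F
≐-refl A = ⇔.refl

≐-sym : ∀ {n} {F G : Family n} → F ≐ G → G ≐ F
≐-sym F≐G A = ⇔.sym (F≐G A)

≐-trans : ∀ {n} {F G H : Family n} → F ≐ G → G ≐ H → F ≐ H
≐-trans F≐G G≐H A = ⇔.trans (F≐G A) (G≐H A)

⩽-refl : ∀ {n} {F : Family n} → F ⩽ F
⩽-refl A FA = A , FA , ⊆-refl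

⩽-trans : ∀ {n} {F G H : Family n} → F ⩽ G → G ⩽ H → F ⩽ H
⩽-trans F⩽G G⩽H A FA with B , GB , B⊆A ← F⩽G A FA with C , HC , C⊆B ← G⩽H B GB = C , HC , ⊆-trans C⊆B B⊆A

⩽-respʳ-≐ : ∀ {n} {F G H : Family n} → F ⩽ G → G ≐ H → F ⩽ H
⩽-respʳ-≐ F⩽G G≐H A FA with B , GB , B⊆A ← F⩽G A FA = B , to (G≐H B) GB , B⊆A

IsHypergraph-resp-≐ : ∀ {n} {F G : Family n} → F ≐ G → IsHypergraph F → IsHypergraph G
IsHypergraph-resp-≐ F≐G ((A , FA) , nonempty , antichain) =
  (A , to (F≐G A) FA) , (λ A GA → nonempty A (from (F≐G A) GA)) ,
  λ A B GA GB → antichain A B (from (F≐G A) GA) (from (F≐G B) GB)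

IsDominationHypergraph-resp-≐ : ∀ {n} {F G : Family n} → F ≐ G → IsDominationHypergraph F → IsDominationHypergraph G
IsDominationHypergraph-resp-≐ F≐G (hypF , D , F≐𝒟D) = IsHypergraph-resp-≐ F≐G hypF , D , ≐-trans (≐-sym F≐G) F≐𝒟D

-- From F ⩽ G ⩽ F we get C ⊆ B ⊆ A with A, C ∈ F; as F is an antichain, A = C = B.
⩽-antisym : ∀ {n} {F G : Family n} → IsHypergraph F → IsHypergraph G → F ⩽ G → G ⩽ F → F ≐ G
⩽-antisym hypF hypG F⩽G G⩽F A = mk⇔ (⩽-⩾⇒⊆ hypF F⩽G G⩽F) (⩽-⩾⇒⊆ hypG G⩽F F⩽G)
  where
  ⩽-⩾⇒⊆ : ∀ {F G : Family _} → IsHypergraph F → F ⩽ G → G ⩽ F → F A → G A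
  ⩽-⩾⇒⊆ {F} {G} (_ , _ , antichain) F⩽G G⩽F FA with B , GB , B⊆A ← F⩽G A FA with C , FC , C⊆B ← G⩽F B GB
    = subst G (⊆-antisym B⊆A (⊆-trans A⊆C C⊆B)) GB
    where
    A⊆C : A ⊆ C
    A⊆C = ⊆∧⊄⇒⊇ (⊆-trans C⊆B B⊆A) (antichain C A FC FA)

antichain-⊇𝒰⇒≐𝒰 : ∀ {n k} {H : Family n} → IsHypergraph H → k ≤ n → (∀ A → ∣ A ∣ ≡ k → H A) → H ≐ 𝒰 k
antichain-⊇𝒰⇒≐𝒰 {n} {k} {H} (_ , _ , antichain) k≤n H⊇𝒰 A = mk⇔ size (H⊇𝒰 A)
  where
  size : H A → ∣ A ∣ ≡ k
  size HA with <-cmp ∣ A ∣ k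
  ... | tri≈ _ ∣A∣≡k _ = ∣A∣≡k
  ... | tri< ∣A∣<k _ _ with K , A⊆K , ∣K∣≡k ← superset-of-size (<⇒≤ ∣A∣<k) k≤n =
    ⊥-elim (antichain A K HA (H⊇𝒰 K ∣K∣≡k) (⊆∧∣<∣⇒⊂ A⊆K (subst (∣ A ∣ <_) (sym ∣K∣≡k) ∣A∣<k)))
  ... | tri> _ _ k<∣A∣ with K , K⊆A , ∣K∣≡k ← subset-of-size (<⇒≤ k<∣A∣) =
    ⊥-elim (antichain K A (H⊇𝒰 K ∣K∣≡k) HA (⊆∧∣<∣⇒⊂ K⊆A (subst (_< ∣ A ∣) (sym ∣K∣≡k) k<∣A∣)))

relabellingInvariant-hypergraph⇒≐𝒰 : ∀ {n} {H : Family n} → IsHypergraph H → RelabellingInvariant H →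
                                     ∃[ k ] 0 < k × H ≐ 𝒰 k
relabellingInvariant-hypergraph⇒≐𝒰 hypH@((A₀ , HA₀) , nonempty , _) invariant =
  ∣ A₀ ∣ , 0<∣A₀∣ , antichain-⊇𝒰⇒≐𝒰 hypH (∣p∣≤n A₀) λ A ∣A∣≡∣A₀∣ → invariant⇒size-determined invariant (sym ∣A∣≡∣A₀∣) HA₀
  where
  0<∣A₀∣ : 0 < ∣ A₀ ∣
  0<∣A₀∣ = let x , x∈A₀ = nonempty A₀ HA₀ in ≤-<-trans z≤n (x∈p⇒∣p-x∣<∣p∣ x∈A₀)

𝒰⩽𝒰⇒≤ : ∀ {n r k} → r ≤ n → 𝒰 {n} r ⩽ 𝒰 k → k ≤ r
𝒰⩽𝒰⇒≤ {n} r≤n 𝒰r⩽𝒰k with R , _ , ∣R∣≡r ← subset-of-size {C = ⊤} (subst (_ ≤_) (sym (∣⊤∣≡n n)) r≤n)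
  with B , ∣B∣≡k , B⊆R ← 𝒰r⩽𝒰k R ∣R∣≡r = subst₂ _≤_ ∣B∣≡k ∣R∣≡r (p⊆q⇒∣p∣≤∣q∣ B⊆R)

𝒰-hasGroundSet : ∀ {n r} → 1 ≤ r → r ≤ n → HasGroundSet (𝒰 {n} r)
𝒰-hasGroundSet 1≤r r≤n x with K , ⁅x⁆⊆K , ∣K∣≡r ← superset-of-size (subst (_≤ _) (sym (∣⁅x⁆∣≡1 x)) 1≤r) r≤n
  = K , ∣K∣≡r , ⁅x⁆⊆K (x∈⁅x⁆ x)

-- Dominating sets

DecidableGraph : ∀ {n} → Graph n → Set
DecidableGraph {n} G = ∀ (u v : Fin n) → Dec (Adj G u v)

¬¬-decidableGraph : ∀ {n} (G : Graph n) → ¬ ¬ DecidableGraph G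
¬¬-decidableGraph G = ¬¬-sequence λ u → ¬¬-sequence λ v → ¬¬-excluded-middle
  where
  ¬¬-sequence : ∀ {n} {P : Fin n → Set} → (∀ i → ¬ ¬ P i) → ¬ ¬ (∀ i → P i)
  ¬¬-sequence = sequence (RawMonad.rawApplicative ¬¬-Monad)

module _ {n} {G : Graph n} where

  dominated? : DecidableGraph G → ∀ D v → Dec (v ∉ D → ∃[ u ] u ∈ D × Adj G u v)
  dominated? adj? D v = ¬? (v ∈? D) →-dec any? λ u → (u ∈? D) ×-dec adj? u v

  dominating? : DecidableGraph G → ∀ D → Dec (Dominating G D)
  dominating? adj? D = all? (dominated? adj? D)

  Dominating-⊆ : ∀ {D D'} → D ⊆ D' → Dominating G D → Dominating G D'
  Dominating-⊆ D⊆D' domD v v∉D' with u , u∈D , u~v ← domD v (λ v∈D → v∉D' (D⊆D' v∈D)) = u , D⊆D' u∈D , u~v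

  Dominating-⊆-graph : ∀ {G' D} → (∀ {u v} → Adj G' u v → Adj G u v) → Dominating G' D → Dominating G D
  Dominating-⊆-graph G'⊆G domD v v∉D with u , u∈D , u~v ← domD v v∉D = u , u∈D , G'⊆G u~v

  ¬Dominating⇒∃undominated : DecidableGraph G → ∀ {D} → ¬ Dominating G D →
                             ∃[ y ] y ∉ D × (∀ u → u ∈ D → ¬ Adj G u y)
  ¬Dominating⇒∃undominated adj? {D} ¬domD with y , ¬dominated ← ¬∀⟶∃¬ n _ (dominated? adj? D) ¬domD
    = y , (λ y∈D → ¬dominated λ y∉D → ⊥-elim (y∉D y∈D)) , λ u u∈D u~y → ¬dominated λ _ → u , u∈D , u~y

  unremovable⇒MinDominating : ∀ {D} → Dominating G D → (∀ u → u ∈ D → ¬ Dominating G (D - u)) → MinDominating G D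
  unremovable⇒MinDominating domD unremovable = domD , λ where
    D' (D'⊆D , z , z∈D , z∉D') domD' → unremovable z z∈D (Dominating-⊆ (p⊆q∧x∉p⇒p⊆q-x D'⊆D z∉D') domD')

  Dominating⇒∃MinDominating-⊆ : DecidableGraph G → ∀ {D} → Dominating G D → ∃[ B ] B ⊆ D × MinDominating G B
  Dominating⇒∃MinDominating-⊆ adj? = go (⊂-wellFounded _)
    where
    go : ∀ {D} → Acc _⊂_ D → Dominating G D → ∃[ B ] B ⊆ D × MinDominating G B
    go {D} (acc smaller) domD with any? (λ u → (u ∈? D) ×-dec dominating? adj? (D - u))
    ... | yes (u , u∈D , domD-u) with B , B⊆D-u , minB ← go (smaller (x∈p⇒p-x⊂p u∈D)) domD-u
      = B , ⊆-trans B⊆D-u (p─q⊆p D ⁅ u ⁆) , minB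
    ... | no ¬removable = D , ⊆-refl , unremovable⇒MinDominating domD λ u u∈D domD-u → ¬removable (u , u∈D , domD-u)

𝒟-isHypergraph : ∀ {n} {G : Graph n} → DecidableGraph G → Fin n → IsHypergraph (𝒟 G)
𝒟-isHypergraph {G = G} adj? v = ∃-member , nonempty , antichain
  where
  ∃-member : ∃[ A ] 𝒟 G A
  ∃-member with B , _ , minB ← Dominating⇒∃MinDominating-⊆ {G = G} adj? {⊤} (λ v v∉⊤ → ⊥-elim (v∉⊤ ∈⊤)) = B , minB
  nonempty : ∀ A → 𝒟 G A → Nonempty A
  nonempty A (domA , _) with v ∈? A
  ... | yes v∈A = v , v∈A
  ... | no v∉A with u , u∈A , _ ← domA v v∉A = u , u∈A
  antichain : ∀ A B → 𝒟 G A → 𝒟 G B → ¬ A ⊂ B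
  antichain A B (domA , _) (_ , minB) A⊂B = minB A A⊂B domA

module _ {n} {G : Graph n} (adj? : DecidableGraph G) where

  nonNeighbours : Fin n → Subset n
  nonNeighbours w = decSubset λ u → ¬? (adj? u w)

  nonNeighbours-dominating : ∀ w → Dominating G (nonNeighbours w)
  nonNeighbours-dominating w v v∉N with adj? v w
  ... | yes v~w = w , ∈-decSubset⁺ (λ u → ¬? (adj? u w)) (irrefl G) , Graph.sym G v~w
  ... | no v≁w = ⊥-elim (v∉N (∈-decSubset⁺ (λ u → ¬? (adj? u w)) v≁w))

  -- A minimal dominating set among the non-neighbours of w must contain w itself.
  𝒟-hasGroundSet : HasGroundSet (𝒟 G)
  𝒟-hasGroundSet w with B , B⊆N , minB@(domB , _) ← Dominating⇒∃MinDominating-⊆ {G = G} adj? (nonNeighbours-dominating w)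
    with w ∈? B
  ... | yes w∈B = B , minB , w∈B
  ... | no w∉B with u , u∈B , u~w ← domB w w∉B = ⊥-elim (∈-decSubset⁻ (λ u → ¬? (adj? u w)) (B⊆N u∈B) u~w)

𝒟-antitone : ∀ {n} {G H : Graph n} → DecidableGraph H → (∀ {u v} → Adj G u v → Adj H u v) → 𝒟 G ⩽ 𝒟 H
𝒟-antitone {G = G} {H} adj? G⊆H A (domA , _)
  with B , B⊆A , minB ← Dominating⇒∃MinDominating-⊆ {G = H} adj? (Dominating-⊆-graph {G = H} {G} G⊆H domA)
  = B , minB , B⊆A

-- Relabelling graphs and domination completions

relabelᶠ : ∀ {n} → Permutation′ n → Family n → Family n
relabelᶠ σ F A = F (relabel σ A)

relabelᴳ : ∀ {n} → Permutation′ n → Graph n → Graph n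
relabelᴳ σ G = record
  { Adj = λ u v → Adj G (σ ⟨$⟩ˡ u) (σ ⟨$⟩ˡ v)
  ; sym = Graph.sym G
  ; irrefl = irrefl G
  }

module _ {n} (σ : Permutation′ n) where

  relabelᶠ-flip : ∀ {F} → relabelᶠ (flip σ) (relabelᶠ σ F) ≐ F
  relabelᶠ-flip {F} A = mk⇔ (subst F (relabel-flip σ A)) (subst F (sym (relabel-flip σ A)))

  flip-relabelᶠ : ∀ {F} → F ≐ relabelᶠ σ (relabelᶠ (flip σ) F)
  flip-relabelᶠ {F} A = mk⇔ (subst F (sym (flip-relabel σ A))) (subst F (flip-relabel σ A))

  relabelᶠ-≐ : ∀ {F G} → F ≐ G → relabelᶠ σ F ≐ relabelᶠ σ G
  relabelᶠ-≐ F≐G A = F≐G (relabel σ A)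

  relabelᶠ-⩽ : ∀ {F G} → F ⩽ G → relabelᶠ σ F ⩽ relabelᶠ σ G
  relabelᶠ-⩽ {G = G} F⩽G A FσA with B , GB , B⊆σA ← F⩽G (relabel σ A) FσA =
    relabel (flip σ) B , subst G (sym (relabel-flip σ B)) GB ,
    subst (relabel (flip σ) B ⊆_) (flip-relabel σ A) (relabel-⊆ (flip σ) B⊆σA)

  relabelᶠ-isHypergraph : ∀ {F} → IsHypergraph F → IsHypergraph (relabelᶠ σ F)
  relabelᶠ-isHypergraph {F} ((A , FA) , nonempty , antichain) =
    (relabel (flip σ) A , subst F (sym (relabel-flip σ A)) FA) ,
    (λ A FσA → let x , x∈σA = nonempty (relabel σ A) FσA in σ ⟨$⟩ʳ x , ∈-relabel⁻ σ x∈σA) ,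
    λ A B FσA FσB A⊂B → antichain _ _ FσA FσB (relabel-⊂ σ A⊂B)

  relabelᶠ-hasGroundSet : ∀ {F} → HasGroundSet F → HasGroundSet (relabelᶠ σ F)
  relabelᶠ-hasGroundSet {F} ground x with B , FB , σ⁻¹x∈B ← ground (σ ⟨$⟩ˡ x) =
    relabel (flip σ) B , subst F (sym (relabel-flip σ B)) FB , ∈-relabel⁺ (flip σ) σ⁻¹x∈B

  module _ (G : Graph n) where

    Dominating-relabel⇒relabelᴳ : ∀ {A} → Dominating G (relabel σ A) → Dominating (relabelᴳ σ G) A
    Dominating-relabel⇒relabelᴳ {A} domσA v v∉A
      with u , u∈σA , u~v ← domσA (σ ⟨$⟩ˡ v) (λ v∈σA → v∉A (subst (_∈ A) (inverseʳ σ) (∈-relabel⁻ σ v∈σA)))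
      = σ ⟨$⟩ʳ u , ∈-relabel⁻ σ u∈σA , subst (λ w → Adj G w (σ ⟨$⟩ˡ v)) (sym (inverseˡ σ)) u~v

    Dominating-relabelᴳ⇒relabel : ∀ {A} → Dominating (relabelᴳ σ G) A → Dominating G (relabel σ A)
    Dominating-relabelᴳ⇒relabel {A} domA w w∉σA
      with u , u∈A , u~w ← domA (σ ⟨$⟩ʳ w) (λ σw∈A → w∉σA (∈-relabel⁺ σ σw∈A))
      = σ ⟨$⟩ˡ u , ∈-relabel⁺ σ (subst (_∈ A) (sym (inverseʳ σ)) u∈A) , subst (Adj G (σ ⟨$⟩ˡ u)) (inverseˡ σ) u~w

    𝒟-relabelᴳ : 𝒟 (relabelᴳ σ G) ≐ relabelᶠ σ (𝒟 G)
    𝒟-relabelᴳ A = mk⇔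
      (λ (domA , minA) → Dominating-relabelᴳ⇒relabel domA , λ D' D'⊂σA domD' →
         minA (relabel (flip σ) D') (subst (relabel (flip σ) D' ⊂_) (flip-relabel σ A) (relabel-⊂ (flip σ) D'⊂σA))
              (Dominating-relabel⇒relabelᴳ (subst (Dominating G) (sym (relabel-flip σ D')) domD')))
      (λ (domσA , minσA) → Dominating-relabel⇒relabelᴳ domσA , λ D' D'⊂A domD' →
         minσA (relabel σ D') (relabel-⊂ σ D'⊂A) (Dominating-relabelᴳ⇒relabel domD'))

  𝒰⩽relabelᶠ-𝒰 : SizePreserving σ → ∀ r → 𝒰 r ⩽ relabelᶠ σ (𝒰 r)
  𝒰⩽relabelᶠ-𝒰 ∣σ∣ r A ∣A∣≡r = A , trans (∣σ∣ A) ∣A∣≡r , ⊆-refl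

  relabelᶠ-Dom : SizePreserving σ → ∀ {r F} → Dom r F → Dom r (relabelᶠ σ F)
  relabelᶠ-Dom ∣σ∣ {r} ((hypF , G , F≐𝒟G) , ground , 𝒰⩽F) =
    (relabelᶠ-isHypergraph hypF , relabelᴳ σ G , ≐-trans (relabelᶠ-≐ F≐𝒟G) (≐-sym (𝒟-relabelᴳ G))) ,
    relabelᶠ-hasGroundSet ground , ⩽-trans (𝒰⩽relabelᶠ-𝒰 ∣σ∣ r) (relabelᶠ-⩽ 𝒰⩽F)

-- A completion H' below Hσ, relabelled back along σ⁻¹, is a completion below H.
relabelᶠ-IsMinimalDom : ∀ {n r} {H : Family n} (σ : Permutation′ n) → SizePreserving σ →
                        IsMinimalDom r H → IsMinimalDom r (relabelᶠ σ H)
relabelᶠ-IsMinimalDom σ ∣σ∣ (DomH , minH) = relabelᶠ-Dom σ ∣σ∣ DomH , λ H' DomH' H'⩽Hσ →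
  let H'σ⁻¹≐H = minH (relabelᶠ (flip σ) H') (relabelᶠ-Dom (flip σ) (flip-sizePreserving {σ = σ} ∣σ∣) DomH')
                     (⩽-respʳ-≐ (relabelᶠ-⩽ (flip σ) H'⩽Hσ) (relabelᶠ-flip σ))
  in ≐-trans (flip-relabelᶠ σ) (relabelᶠ-≐ σ H'σ⁻¹≐H)

unique-minimal⇒relabellingInvariant : ∀ {n r} → ((H , _) : HasUniqueMinimal n r) → RelabellingInvariant H
unique-minimal⇒relabellingInvariant (H , minH , unique) σ ∣σ∣ {A} HA =
  from (unique (relabelᶠ σ H) (relabelᶠ-IsMinimalDom σ ∣σ∣ minH) A) HA

-- Deleting an edge

deleteEdge : ∀ {n} → Graph n → Fin n → Fin n → Graph n
deleteEdge G x y = record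
  { Adj = λ u v → Adj G u v × ¬ (u ≡ x × v ≡ y) × ¬ (u ≡ y × v ≡ x)
  ; sym = λ (u~v , ¬xy , ¬yx) → Graph.sym G u~v , (λ (v≡x , u≡y) → ¬yx (u≡y , v≡x)) , (λ (v≡y , u≡x) → ¬xy (u≡x , v≡y))
  ; irrefl = λ (v~v , _) → irrefl G v~v
  }

deleteEdge? : ∀ {n} {G : Graph n} → DecidableGraph G → ∀ x y → DecidableGraph (deleteEdge G x y)
deleteEdge? adj? x y u v = adj? u v ×-dec ¬? ((u ≟ x) ×-dec (v ≟ y)) ×-dec ¬? ((u ≟ y) ×-dec (v ≟ x))

module _ {n} {G : Graph n} {k} (dominating-k : ∀ K → ∣ K ∣ ≡ k → Dominating G K) where

  dominated-by-large : ∀ {T v} → k ≤ ∣ T ∣ → v ∉ T → ∃[ u ] u ∈ T × Adj G u v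
  dominated-by-large k≤∣T∣ v∉T with K , K⊆T , ∣K∣≡k ← subset-of-size k≤∣T∣
    with u , u∈K , u~v ← dominating-k K ∣K∣≡k _ (λ v∈K → v∉T (K⊆T v∈K))
    = u , K⊆T u∈K , u~v

  neighbour-avoiding : ∀ {T v} → k < ∣ T ∣ → v ∉ T → ∀ w → ∃[ u ] u ∈ T × ¬ u ≡ w × Adj G u v
  neighbour-avoiding {T} k<∣T∣ v∉T w
    with u , u∈T-w , u~v ← dominated-by-large {T = T - w} (m<∣p∣⇒m≤∣p-x∣ T w k<∣T∣) (λ v∈T-w → v∉T (p─q⊆p T ⁅ w ⁆ v∈T-w))
    = u , p─q⊆p T ⁅ w ⁆ u∈T-w , x∈p-y⇒x≢y u∈T-w , u~v

  ∃-neighbour : k < n → ∀ y → ∃[ x ] Adj G x y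
  ∃-neighbour k<n y
    with x , _ , x~y ← dominated-by-large {T = ⊤ - y} (m<∣p∣⇒m≤∣p-x∣ ⊤ y (subst (k <_) (sym (∣⊤∣≡n n)) k<n))
                                                      (λ y∈⊤-y → x∈p-y⇒x≢y y∈⊤-y refl)
    = x , x~y

  -- y is dominated through a neighbour other than x, every other vertex through a neighbour other than y.
  deleteEdge-dominating : ∀ {T} → k < ∣ T ∣ → ∀ x y → Dominating (deleteEdge G x y) T
  deleteEdge-dominating k<∣T∣ x y v v∉T with v ≟ y
  ... | yes refl with u , u∈T , u≢x , u~y ← neighbour-avoiding k<∣T∣ v∉T x =
    u , u∈T , u~y , (λ (u≡x , _) → u≢x u≡x) , λ (u≡y , _) → irrefl G (subst (λ w → Adj G w y) u≡y u~y)
  ... | no v≢y with u , u∈T , u≢y , u~v ← neighbour-avoiding k<∣T∣ v∉T y =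
    u , u∈T , u~v , (λ (_ , v≡y) → v≢y v≡y) , λ (u≡y , _) → u≢y u≡y

deleteEdge-Dom : ∀ {n r k} {G : Graph n} → DecidableGraph G → (∀ K → ∣ K ∣ ≡ k → Dominating G K) → k < r →
                 ∀ x y → Dom r (𝒟 (deleteEdge G x y))
deleteEdge-Dom {r = r} {G = G} adj? dominating-k k<r x y =
  (𝒟-isHypergraph {G = G-xy} adj?′ y , G-xy , ≐-refl) , 𝒟-hasGroundSet {G = G-xy} adj?′ , 𝒰⩽𝒟G-xy
  where
  G-xy : Graph _
  G-xy = deleteEdge G x y
  adj?′ : DecidableGraph G-xy
  adj?′ = deleteEdge? {G = G} adj? x y
  𝒰⩽𝒟G-xy : 𝒰 r ⩽ 𝒟 G-xy
  𝒰⩽𝒟G-xy A ∣A∣≡r with B , B⊆A , minB ← Dominating⇒∃MinDominating-⊆ {G = G-xy} adj?′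
                          (deleteEdge-dominating {G = G} dominating-k (subst (_ <_) (sym ∣A∣≡r) k<r) x y)
    = B , minB , B⊆A

deleteEdge-¬dominating : ∀ {n} {G : Graph n} {Y x y} → y ∉ Y → (∀ u → u ∈ Y → ¬ Adj G u y) → Adj G x y →
                         ¬ Dominating (deleteEdge G x y) (Y ∪ ⁅ x ⁆)
deleteEdge-¬dominating {G = G} {Y} {x} {y} y∉Y Y≁y x~y domX
  with u , u∈X , u~y , ¬xy , _ ← domX y (λ y∈X →
         [ y∉Y , (λ y∈⁅x⁆ → irrefl G (subst (Adj G x) (x∈⁅y⁆⇒x≡y x y∈⁅x⁆) x~y)) ]′ (x∈p∪q⁻ Y ⁅ x ⁆ y∈X))
  = [ (λ u∈Y → Y≁y u u∈Y u~y) , (λ u∈⁅x⁆ → ¬xy (x∈⁅y⁆⇒x≡y x u∈⁅x⁆ , refl)) ]′ (x∈p∪q⁻ Y ⁅ x ⁆ u∈X)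

-- Y lies strictly inside a minimal dominating set, so fails to dominate some y; any neighbour x of y avoids Y.
∃-pendant-configuration : ∀ {n k} {G : Graph n} → DecidableGraph G → (∀ K → ∣ K ∣ ≡ suc k → MinDominating G K) →
                          suc k < n → ∃[ Y ] ∃[ x ] ∃[ y ] ∣ Y ∣ ≡ k × y ∉ Y × (∀ u → u ∈ Y → ¬ Adj G u y) × Adj G x y
∃-pendant-configuration {n} {k} {G} adj? minimal 1+k<n
  with Y , _ , ∣Y∣≡k ← subset-of-size {C = ⊤} (subst (k ≤_) (sym (∣⊤∣≡n n)) (<⇒≤ (<⇒≤ 1+k<n)))
  with K , Y⊆K , ∣K∣≡1+k ← superset-of-size (subst (_≤ suc k) (sym ∣Y∣≡k) (n≤1+n k)) (<⇒≤ 1+k<n)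
  with y , y∉Y , Y≁y ← ¬Dominating⇒∃undominated {G = G} adj?
         (proj₂ (minimal K ∣K∣≡1+k) Y (⊆∧∣<∣⇒⊂ Y⊆K (subst₂ _<_ (sym ∣Y∣≡k) (sym ∣K∣≡1+k) ≤-refl)))
  with x , x~y ← ∃-neighbour {G = G} (λ K ∣K∣≡1+k → proj₁ (minimal K ∣K∣≡1+k)) 1+k<n y
  = Y , x , y , ∣Y∣≡k , y∉Y , Y≁y , x~y

IsMinimalDom⇒¬⊇𝒰 : ∀ {n r k} {H : Family n} {G : Graph n} → IsMinimalDom r H → H ≐ 𝒟 G → DecidableGraph G →
                    0 < k → k < r → r ≤ n → ¬ (∀ A → ∣ A ∣ ≡ k → H A)
IsMinimalDom⇒¬⊇𝒰 {k = suc k} {H} {G} (_ , minH) H≐𝒟G adj? _ 1+k<r r≤n H⊇𝒰 =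
  let Y , x , y , ∣Y∣≡k , y∉Y , Y≁y , x~y = ∃-pendant-configuration {G = G} adj? minimal (<-≤-trans 1+k<r r≤n)
      𝒟G-xy≐H = minH (𝒟 (deleteEdge G x y)) (deleteEdge-Dom {G = G} adj? dominating 1+k<r x y)
                     (⩽-respʳ-≐ (𝒟-antitone {G = deleteEdge G x y} {G} adj? proj₁) (≐-sym H≐𝒟G))
      x∉Y : x ∉ Y
      x∉Y x∈Y = Y≁y x x∈Y x~y
      H[Y∪x] = H⊇𝒰 (Y ∪ ⁅ x ⁆) (trans (x∉p⇒∣p∪⁅x⁆∣≡1+∣p∣ x∉Y) (cong suc ∣Y∣≡k))
  in deleteEdge-¬dominating {G = G} y∉Y Y≁y x~y (proj₁ (from (𝒟G-xy≐H (Y ∪ ⁅ x ⁆)) H[Y∪x]))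
  where
  minimal : ∀ K → ∣ K ∣ ≡ suc k → MinDominating G K
  minimal K ∣K∣≡1+k = to (H≐𝒟G K) (H⊇𝒰 K ∣K∣≡1+k)
  dominating : ∀ K → ∣ K ∣ ≡ suc k → Dominating G K
  dominating K ∣K∣≡1+k = proj₁ (minimal K ∣K∣≡1+k)

unique-minimal⇒𝒰-isDominationHypergraph : ∀ {n r} → r ≤ n → HasUniqueMinimal n r → IsDominationHypergraph (𝒰 {n} r)
unique-minimal⇒𝒰-isDominationHypergraph r≤n unique@(H , minH@((domH@(hypH , G , H≐𝒟G) , _ , 𝒰r⩽H) , _) , _)
  with k , 0<k , H≐𝒰k ← relabellingInvariant-hypergraph⇒≐𝒰 hypH (unique-minimal⇒relabellingInvariant unique)
  with m≤n⇒m<n∨m≡n (𝒰⩽𝒰⇒≤ r≤n (⩽-respʳ-≐ 𝒰r⩽H H≐𝒰k))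
... | inj₂ refl = IsDominationHypergraph-resp-≐ H≐𝒰k domH
-- Refuting k < r is a negative goal, so adjacency in G may be assumed decidable.
... | inj₁ k<r = ⊥-elim (¬¬-decidableGraph G λ adj? →
  IsMinimalDom⇒¬⊇𝒰 {G = G} minH H≐𝒟G adj? 0<k k<r r≤n λ A → from (H≐𝒰k A))

𝒰-isDominationHypergraph⇒unique-minimal : ∀ {n r} → 1 ≤ r → r ≤ n → IsDominationHypergraph (𝒰 {n} r) →
                                           HasUniqueMinimal n r
𝒰-isDominationHypergraph⇒unique-minimal {r = r} 1≤r r≤n dom𝒰@(hyp𝒰 , _) = 𝒰 r , (Dom𝒰 , minimal) , unique
  where
  Dom𝒰 : Dom r (𝒰 r)
  Dom𝒰 = dom𝒰 , 𝒰-hasGroundSet 1≤r r≤n , ⩽-refl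
  minimal : ∀ H → Dom r H → H ⩽ 𝒰 r → H ≐ 𝒰 r
  minimal H ((hypH , _) , _ , 𝒰⩽H) H⩽𝒰 = ⩽-antisym hypH hyp𝒰 H⩽𝒰 𝒰⩽H
  unique : ∀ H → IsMinimalDom r H → H ≐ 𝒰 r
  unique H ((_ , _ , 𝒰⩽H) , minH) = ≐-sym (minH (𝒰 r) Dom𝒰 𝒰⩽H)

theorem3p4 : (n r : ℕ) → 1 ≤ r → r ≤ n →
    (HasUniqueMinimal n r → IsDominationHypergraph (𝒰 {n} r))
    × (IsDominationHypergraph (𝒰 {n} r) → HasUniqueMinimal n r)
theorem3p4 n r 1≤r r≤n =
  unique-minimal⇒𝒰-isDominationHypergraph r≤n , 𝒰-isDominationHypergraph⇒unique-minimal 1≤r r≤n
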